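{- Let $S$ be a set of $n$ keys and let $h_0,h_1:S\to[n]$ be independent uniformly random functions, and let $G$ be the multigraph with node set $[n]$ and edge multiset $\{\{h_0(x),h_1(x)\} \mid x\in S\}$. Let $x_1,\dots,x_{2n}\in[n]$ be independent and uniformly random. Then each of the following random multigraphs has the same distribution as $G$: (1) $G_1=([n],\{\{x_{2i-1},x_{2i}\}\mid i\in[n]\})$; (2) $G_2=([n],\{\{x_i,x_j\}\mid \{i,j\}\in M\})$, where $M$ is a uniformly random perfect matching of $[2n]$ (a partition of $[2n]$ into $n$ sets of size $2$), independent of $x_1,\dots,x_{2n}$; (3) $G_3$, defined like $G_2$ except that $M$ is built in $n$ rounds: in each round an unmatched number $i\in[2n]$ is chosen arbitrarily (the choice may depend on $x_1,\dots,x_{2n}$ and on the set of previously matched numbers) and is matched to a distinct unmatched number $j$ chosen uniformly at random among the unmatched numbers other than $i$.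
   Context: All edge sets are multisets; self-loops and multi-edges are allowed. The hash functions $h_0,h_1$ are assumed fully random. -}

module Defs where

open import Data.Nat using (ℕ; zero; suc; _*_; _∸_; _<ᵇ_; _≡ᵇ_)
open import Data.Fin using (Fin; zero; suc; toℕ; combine; _≟_)
open import Data.Fin.Subset using (Subset; ⊥; _∪_; ⁅_⁆)
open import Data.Vec using (lookup)
open import Data.Bool using (Bool; true; false; not; _∧_; _∨_; if_then_else_)
open import Data.List using (List; []; _∷_; [_]; map; concatMap; length; foldl; allFin)
open import Data.Maybe using (Maybe; just; nothing)
open import Data.Product using (_×_; _,_; proj₁; proj₂; ∃-syntax)
open import Relation.Nullary.Decidable using (⌊_⌋)
open import Relation.Binary.PropositionalEquality using (_≡_)

-- Finite uniform sample spaces, enumerated as lists of outcomes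

consΠ : ∀ {k} {B : Fin (suc k) → ℕ} → Fin (B zero) →
        ((i : Fin k) → Fin (B (suc i))) → (i : Fin (suc k)) → Fin (B i)
consΠ a f zero    = a
consΠ a f (suc i) = f i

allΠ : ∀ k (B : Fin k → ℕ) → List ((i : Fin k) → Fin (B i))
allΠ zero    B = [ (λ ()) ]
allΠ (suc k) B =
  concatMap (λ a → map (λ f → consΠ {B = B} a f) (allΠ k (λ i → B (suc i))))
            (allFin (B zero))

allFuns : ∀ k m → List (Fin k → Fin m)
allFuns k m = allΠ k (λ _ → m)

allPairs : ∀ {A B : Set} → List A → List B → List (A × B)
allPairs xs ys = concatMap (λ x → map (λ y → (x , y)) ys) xs

countB : ∀ {A : Set} → (A → Bool) → List A → ℕ
countB p []       = 0
countB p (x ∷ xs) = if p x then suc (countB p xs) else countB p xs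

allB : ∀ {A : Set} → (A → Bool) → List A → Bool
allB p []       = true
allB p (x ∷ xs) = p x ∧ allB p xs

_==_ : ∀ {k} → Fin k → Fin k → Bool
i == j = ⌊ i ≟ j ⌋

-- Multigraphs on node set [n] = Fin n, given by a list of edges
-- (each edge an unordered pair, stored as an ordered pair).

Edges : ℕ → Set
Edges n = List (Fin n × Fin n)

endpointsAre : ∀ {n} → Fin n × Fin n → Fin n → Fin n → Bool
endpointsAre (p , q) a b = (p == a ∧ q == b) ∨ (p == b ∧ q == a)

mult : ∀ {n} → Edges n → Fin n → Fin n → ℕ
mult E a b = countB (λ e → endpointsAre e a b) E

sameGraph : ∀ {n} → Edges n → Edges n → Bool
sameGraph {n} E F =
  allB (λ ab → mult E (proj₁ ab) (proj₂ ab) ≡ᵇ mult F (proj₁ ab) (proj₂ ab))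
      (allPairs (allFin n) (allFin n))

countGraph : ∀ {n} {A : Set} → List A → (A → Edges n) → Edges n → ℕ
countGraph Ω g H = countB (λ ω → sameGraph (g ω) H) Ω

-- Two random multigraphs, each a function of a uniformly random outcome
-- of a finite sample space, have the same distribution:
-- Pr₁[G = H] = Pr₂[G = H] for every multigraph H (cross-multiplied).
SameDist : ∀ {n} {A B : Set} → List A → (A → Edges n) →
           List B → (B → Edges n) → Set
SameDist Ω₁ g₁ Ω₂ g₂ =
  ∀ H → countGraph Ω₁ g₁ H * length Ω₂ ≡ countGraph Ω₂ g₂ H * length Ω₁

-- G : keys S = Fin n, h₀ h₁ : S → [n] uniform and independent

ΩG : ∀ n → List ((Fin n → Fin n) × (Fin n → Fin n))
ΩG n = allPairs (allFuns n n) (allFuns n n)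

graphG : ∀ {n} → (Fin n → Fin n) × (Fin n → Fin n) → Edges n
graphG {n} (h₀ , h₁) = map (λ x → (h₀ x , h₁ x)) (allFin n)

-- x₁ … x_{2n} ∈ [n] : indices in [2n] are Fin (n * 2);
-- x_{2i-1}, x_{2i} correspond to combine i 0, combine i 1.

Xs : ℕ → Set
Xs n = Fin (n * 2) → Fin n

ΩX : ∀ n → List (Xs n)
ΩX n = allFuns (n * 2) n

graph1 : ∀ {n} → Xs n → Edges n
graph1 {n} x = map (λ i → (x (combine i zero) , x (combine i (suc zero)))) (allFin n)

-- perfect matchings of [2n] : fixed-point-free involutions M of Fin (n * 2)
-- (M i is the partner of i; the pairs are {i , M i})
isPerfectMatching : ∀ {m} → (Fin m → Fin m) → Bool
isPerfectMatching {m} M = allB (λ i → M (M i) == i ∧ not (M i == i)) (allFin m)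

filterB : ∀ {A : Set} → (A → Bool) → List A → List A
filterB p []       = []
filterB p (x ∷ xs) = if p x then x ∷ filterB p xs else filterB p xs

allMatchings : ∀ m → List (Fin m → Fin m)
allMatchings m = filterB isPerfectMatching (allFuns m m)

-- G₂ : one edge {x_i , x_j} per pair {i , j} ∈ M (listed once, with i < j)
graph2 : ∀ {n} → Xs n × (Fin (n * 2) → Fin (n * 2)) → Edges n
graph2 {n} (x , M) =
  map (λ i → (x i , x (M i))) (filterB (λ i → toℕ i <ᵇ toℕ (M i)) (allFin (n * 2)))

Ω2 : ∀ n → List (Xs n × (Fin (n * 2) → Fin (n * 2)))
Ω2 n = allPairs (ΩX n) (allMatchings (n * 2))

Strategy : ℕ → Set
Strategy n = Xs n → Subset (n * 2) → Fin (n * 2)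

ValidStrategy : ∀ {n} → Strategy n → Set
ValidStrategy {n} σ =
  ∀ (x : Xs n) (s : Subset (n * 2)) →
    (∃[ j ] lookup s j ≡ false) → lookup s (σ x s) ≡ false

lookupℕ : ∀ {A : Set} → List A → ℕ → Maybe A
lookupℕ []       _       = nothing
lookupℕ (a ∷ as) zero    = just a
lookupℕ (a ∷ as) (suc k) = lookupℕ as k

choices : ∀ n → Fin n → ℕ
choices n k = n * 2 ∸ 1 ∸ 2 * toℕ k

-- one round: i := σ x s ; j := the c-th unmatched number other than i
step : ∀ {n} → Xs n → Strategy n → ℕ →
       Subset (n * 2) × Edges n → Subset (n * 2) × Edges n
step {n} x σ c (s , E) with lookupℕ (filterB (λ j → not (lookup s j) ∧ not (j == σ x s)) (allFin (n * 2))) c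
... | just j  = (s ∪ ⁅ σ x s ⁆ ∪ ⁅ j ⁆ , (x (σ x s) , x j) ∷ E)
... | nothing = (s , E)   -- unreachable for valid strategies

Choices : ℕ → Set
Choices n = (k : Fin n) → Fin (choices n k)

graph3 : ∀ {n} → Strategy n → Xs n × Choices n → Edges n
graph3 {n} σ (x , c) =
  proj₂ (foldl (λ st k → step x σ (toℕ (c k)) st) (⊥ , []) (allFin n))

Ω3 : ∀ n → List (Xs n × Choices n)
Ω3 n = allPairs (ΩX n) (allΠ n (choices n))

{-# OPTIONS --safe #-}
-- Every random multigraph of the statement is read off a uniform x ∈ [n]^{2n} along a perfect
-- pairing of [2n]. For a fixed perfect pairing, reindexing x along the bijection between [2n]
-- and pairs × {1,2} permutes the sample space, so the multigraph is distributed as G₁; and G is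
-- G₁ after interleaving h₀ with h₁. Hence G₂, a mixture over M, is distributed as G₁.
-- For G₃, the number of choice sequences ending in a given multigraph does not depend on the
-- strategy: if two strategies start with numbers i ≠ i′, let each take the other's number next
-- while it is unmatched; the two-round sums then agree after exchanging the two rounds. So σ
-- may be frozen at a fixed x₀, and a strategy that ignores x enumerates a fixed list of
-- perfect pairings.
module Submission where

open import Defs
open import Data.Bool using (Bool; true; false; not; _∧_; _∨_; if_then_else_)
open import Data.Bool.Properties using (∧-commutativeMonoid; ∧-comm; ∧-zeroʳ; ∨-comm; not-injective; T-≡; ⇔→≡)
open import Data.Empty using (⊥-elim)
open import Data.Fin using (Fin; zero; suc; toℕ; combine; remQuot; quotient; _≟_)
open import Data.Fin.Properties
  using (toℕ-injective; remQuot-combine; combine-remQuot; cantor-schröder-bernstein)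
  renaming (suc-injective to fsuc-injective)
open import Data.Fin.Subset using (Subset; _∪_; ⁅_⁆) renaming (⊥ to ∅)
open import Data.Fin.Subset.Properties using (∪-comm; ∪-assoc)
open import Data.List using (List; []; _∷_; [_]; map; concatMap; length; foldl; allFin; tabulate; _++_; lookup)
open import Data.List.Properties using (map-cong; map-tabulate; tabulate-lookup; map-∘; ++-identityʳ; length-tabulate; length-map)
open import Data.List.Relation.Unary.All as All using (All; []; _∷_)
open import Data.List.Relation.Unary.AllPairs as AllPairs using (AllPairs; []; _∷_)
open import Data.List.Relation.Unary.Any as Any using (Any; here; there)
open import Data.List.Relation.Unary.All.Properties as Allₚ using (tabulate⁺; tabulate⁻)
open import Data.List.Relation.Unary.Any.Properties as Anyₚ using (lookup-index)
open import Data.List.Relation.Unary.AllPairs.Properties as AllPairsₚ using ()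
open import Data.List.Membership.Propositional using (_∈_)
open import Data.List.Membership.Propositional.Properties using (∈-lookup; ∈-allFin)
open import Data.List.Relation.Unary.Unique.Propositional.Properties using (allFin⁺)
open import Data.Maybe using (Maybe; just; nothing)
open import Data.Nat using (ℕ; zero; suc; _+_; _*_; _∸_; _<_; _<ᵇ_; _≡ᵇ_)
open import Data.Nat.Properties hiding (_≟_)
open import Data.Nat.Solver using (module +-*-Solver)
open import Data.Product using (_×_; _,_; proj₁; proj₂; ∃; ∃-syntax)
import Data.Vec as Vec
open import Data.Vec.Properties using (lookup-zipWith; lookup-replicate)
open import Function using (_∘_; id)
open import Function.Bundles using (mk⇔; Equivalence)
open import Relation.Binary.PropositionalEquality hiding ([_])
open import Relation.Nullary using (¬_; yes; no)
open import Relation.Nullary.Decidable using (isYes≗does; dec-true; dec-false; does-⇔; ⌊⌋-map′; toWitness)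
open import Algebra.Properties.CommutativeSemigroup +-commutativeSemigroup using (interchange)
open import Algebra.Solver.CommutativeMonoid ∧-commutativeMonoid using (solve; _⊜_; _⊕_)

private variable
  A B : Set

∧-true : ∀ {b c} → b ∧ c ≡ true → b ≡ true × c ≡ true
∧-true {true} {true} _ = refl , refl

∧-intro : ∀ {b c} → b ≡ true → c ≡ true → b ∧ c ≡ true
∧-intro refl refl = refl

-- Sums and counts over lists

_⊙_ : Bool → ℕ → ℕ
b ⊙ v = if b then v else 0

⊙-cong : ∀ b {u v} → (b ≡ true → u ≡ v) → b ⊙ u ≡ b ⊙ v
⊙-cong true  u≡v = u≡v refl
⊙-cong false _   = refl

⊙-cong₂ : ∀ {b c u v} → b ≡ c → (b ≡ true → u ≡ v) → b ⊙ u ≡ c ⊙ v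
⊙-cong₂ {b} refl = ⊙-cong b

⊙-∧ : ∀ b c v → b ⊙ (c ⊙ v) ≡ (b ∧ c) ⊙ v
⊙-∧ true  c v = refl
⊙-∧ false c v = refl

⊙-split : ∀ b c v → b ⊙ v ≡ (b ∧ c) ⊙ v + (b ∧ not c) ⊙ v
⊙-split true  true  v = sym (+-identityʳ v)
⊙-split true  false v = refl
⊙-split false c     v = refl

sumL : (A → ℕ) → List A → ℕ
sumL f []       = 0
sumL f (a ∷ as) = f a + sumL f as

sumL-cong : ∀ {f g : A → ℕ} → (∀ a → f a ≡ g a) → ∀ L → sumL f L ≡ sumL g L
sumL-cong f≗g []      = refl
sumL-cong f≗g (a ∷ L) = cong₂ _+_ (f≗g a) (sumL-cong f≗g L)

sumL-congᴬ : ∀ {f g : A → ℕ} {L} → All (λ a → f a ≡ g a) L → sumL f L ≡ sumL g L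
sumL-congᴬ []       = refl
sumL-congᴬ (e ∷ es) = cong₂ _+_ e (sumL-congᴬ es)

sumL-zero : ∀ (L : List A) → sumL (λ _ → 0) L ≡ 0
sumL-zero []      = refl
sumL-zero (a ∷ L) = sumL-zero L

sumL-zeroᴬ : ∀ {f : A → ℕ} {L} → All (λ a → f a ≡ 0) L → sumL f L ≡ 0
sumL-zeroᴬ {L = L} f≡0 = trans (sumL-congᴬ f≡0) (sumL-zero L)

sumL-+ : ∀ (f g : A → ℕ) L → sumL (λ a → f a + g a) L ≡ sumL f L + sumL g L
sumL-+ f g []      = refl
sumL-+ f g (a ∷ L) = trans (cong (f a + g a +_) (sumL-+ f g L)) (interchange (f a) (g a) _ _)

sumL-*ˡ : ∀ k (f : A → ℕ) L → sumL (λ a → k * f a) L ≡ k * sumL f L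
sumL-*ˡ k f []      = sym (*-zeroʳ k)
sumL-*ˡ k f (a ∷ L) = trans (cong (k * f a +_) (sumL-*ˡ k f L)) (sym (*-distribˡ-+ k (f a) _))

sumL-*ʳ : ∀ k (f : A → ℕ) L → sumL (λ a → f a * k) L ≡ sumL f L * k
sumL-*ʳ k f L = trans (sumL-cong (λ a → *-comm (f a) k) L) (trans (sumL-*ˡ k f L) (*-comm k _))

sumL-⊙ : ∀ b (f : A → ℕ) L → b ⊙ sumL f L ≡ sumL (λ a → b ⊙ f a) L
sumL-⊙ true  f L = refl
sumL-⊙ false f L = sym (sumL-zero L)

sumL-++ : ∀ (f : A → ℕ) L M → sumL f (L ++ M) ≡ sumL f L + sumL f M
sumL-++ f []      M = refl
sumL-++ f (a ∷ L) M = trans (cong (f a +_) (sumL-++ f L M)) (sym (+-assoc (f a) _ _))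

sumL-map : ∀ (f : B → ℕ) (g : A → B) L → sumL f (map g L) ≡ sumL (f ∘ g) L
sumL-map f g []      = refl
sumL-map f g (a ∷ L) = cong (f (g a) +_) (sumL-map f g L)

sumL-concatMap : ∀ (f : B → ℕ) (g : A → List B) L →
  sumL f (concatMap g L) ≡ sumL (λ a → sumL f (g a)) L
sumL-concatMap f g []      = refl
sumL-concatMap f g (a ∷ L) =
  trans (sumL-++ f (g a) (concatMap g L)) (cong (sumL f (g a) +_) (sumL-concatMap f g L))

sumL-swap : ∀ (f : A → B → ℕ) L M →
  sumL (λ a → sumL (f a) M) L ≡ sumL (λ b → sumL (λ a → f a b) L) M
sumL-swap f []      M = sym (sumL-zero M)
sumL-swap f (a ∷ L) M =
  trans (cong (sumL (f a) M +_) (sumL-swap f L M)) (sym (sumL-+ (f a) (λ b → sumL (λ a → f a b) L) M))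

sumL-allPairs : ∀ (f : A × B → ℕ) L M →
  sumL f (allPairs L M) ≡ sumL (λ a → sumL (λ b → f (a , b)) M) L
sumL-allPairs f L M =
  trans (sumL-concatMap f (λ a → map (a ,_) M) L) (sumL-cong (λ a → sumL-map f (a ,_) M) L)

sumL-tabulate : ∀ {k} (f : A → ℕ) (h : Fin k → A) → sumL f (tabulate h) ≡ sumL (f ∘ h) (allFin k)
sumL-tabulate f h = trans (cong (sumL f) (sym (map-tabulate id h))) (sumL-map f h (allFin _))

sumL-filterB : ∀ (p : A → Bool) (f : A → ℕ) L → sumL f (filterB p L) ≡ sumL (λ a → p a ⊙ f a) L
sumL-filterB p f []      = refl
sumL-filterB p f (a ∷ L) with p a
... | true  = cong (f a +_) (sumL-filterB p f L)
... | false = sumL-filterB p f L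

sumL-lookupℕ : ∀ (L : List A) {b} → length L ≡ b → (Φ : Maybe A → ℕ) →
  sumL (λ a → Φ (lookupℕ L (toℕ a))) (allFin b) ≡ sumL (Φ ∘ just) L
sumL-lookupℕ []      refl Φ = refl
sumL-lookupℕ (y ∷ L) refl Φ =
  cong (Φ (just y) +_) (trans (sumL-tabulate {k = length L} _ suc) (sumL-lookupℕ L refl Φ))

foldl-tabulate : ∀ {S : Set} {k} (g : S → A → S) st (h : Fin k → A) →
  foldl g st (tabulate h) ≡ foldl (λ st i → g st (h i)) st (allFin k)
foldl-tabulate {k = zero}  g st h = refl
foldl-tabulate {k = suc k} g st h =
  trans (foldl-tabulate g (g st (h zero)) (h ∘ suc)) (sym (foldl-tabulate (λ st i → g st (h i)) (g st (h zero)) suc))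

countB≡sumL : ∀ (p : A → Bool) L → countB p L ≡ sumL (λ a → p a ⊙ 1) L
countB≡sumL p []      = refl
countB≡sumL p (a ∷ L) with p a
... | true  = cong suc (countB≡sumL p L)
... | false = countB≡sumL p L

countB-cong : ∀ {p q : A → Bool} → (∀ a → p a ≡ q a) → ∀ L → countB p L ≡ countB q L
countB-cong p≗q L =
  trans (countB≡sumL _ L) (trans (sumL-cong (λ a → cong (_⊙ 1) (p≗q a)) L) (sym (countB≡sumL _ L)))

countB-false : ∀ (L : List A) → countB (λ _ → false) L ≡ 0
countB-false L = trans (countB≡sumL _ L) (sumL-zero L)

countB-true : ∀ (L : List A) → countB (λ _ → true) L ≡ length L
countB-true []      = refl
countB-true (a ∷ L) = cong suc (countB-true L)

countB-∧ˡ : ∀ b (p : A → Bool) L → countB (λ a → b ∧ p a) L ≡ b ⊙ countB p L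
countB-∧ˡ true  p L = refl
countB-∧ˡ false p L = countB-false L

countB-*ʳ : ∀ (p : A → Bool) k L → countB p L * k ≡ sumL (λ a → p a ⊙ k) L
countB-*ʳ p k L = begin
  countB p L * k                  ≡⟨ cong (_* k) (countB≡sumL p L) ⟩
  sumL (λ a → p a ⊙ 1) L * k      ≡⟨ sym (sumL-*ʳ k _ L) ⟩
  sumL (λ a → (p a ⊙ 1) * k) L    ≡⟨ sumL-cong (λ a → ⊙-* (p a)) L ⟩
  sumL (λ a → p a ⊙ k) L          ∎
  where
  open ≡-Reasoning
  ⊙-* : ∀ b → (b ⊙ 1) * k ≡ b ⊙ k
  ⊙-* true  = +-identityʳ k
  ⊙-* false = refl

countB-map : ∀ (p : B → Bool) (g : A → B) L → countB p (map g L) ≡ countB (p ∘ g) L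
countB-map p g L =
  trans (countB≡sumL p (map g L)) (trans (sumL-map _ g L) (sym (countB≡sumL (p ∘ g) L)))

countB-concatMap : ∀ (p : B → Bool) (g : A → List B) L →
  countB p (concatMap g L) ≡ sumL (λ a → countB p (g a)) L
countB-concatMap p g L = trans (countB≡sumL p (concatMap g L))
  (trans (sumL-concatMap _ g L) (sumL-cong (λ a → sym (countB≡sumL p (g a))) L))

countB-allPairs : ∀ (p : A → Bool) (q : B → Bool) L M →
  countB (λ ab → p (proj₁ ab) ∧ q (proj₂ ab)) (allPairs L M) ≡ countB p L * countB q M
countB-allPairs p q L M = begin
  countB (λ ab → p (proj₁ ab) ∧ q (proj₂ ab)) (allPairs L M)
    ≡⟨ countB-concatMap _ (λ a → map (a ,_) M) L ⟩
  sumL (λ a → countB (λ ab → p (proj₁ ab) ∧ q (proj₂ ab)) (map (a ,_) M)) L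
    ≡⟨ sumL-cong (λ a → trans (countB-map _ (a ,_) M) (countB-∧ˡ (p a) q M)) L ⟩
  sumL (λ a → p a ⊙ countB q M) L
    ≡⟨ sym (countB-*ʳ p (countB q M) L) ⟩
  countB p L * countB q M ∎
  where open ≡-Reasoning

countB-split : ∀ (p q : A → Bool) L →
  countB p L ≡ countB (λ a → p a ∧ q a) L + countB (λ a → p a ∧ not (q a)) L
countB-split p q L = begin
  countB p L
    ≡⟨ countB≡sumL p L ⟩
  sumL (λ a → p a ⊙ 1) L
    ≡⟨ sumL-cong (λ a → ⊙-split (p a) (q a) 1) L ⟩
  sumL (λ a → (p a ∧ q a) ⊙ 1 + (p a ∧ not (q a)) ⊙ 1) L
    ≡⟨ sumL-+ _ _ L ⟩
  sumL (λ a → (p a ∧ q a) ⊙ 1) L + sumL (λ a → (p a ∧ not (q a)) ⊙ 1) L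
    ≡⟨ sym (cong₂ _+_ (countB≡sumL _ L) (countB≡sumL _ L)) ⟩
  countB (λ a → p a ∧ q a) L + countB (λ a → p a ∧ not (q a)) L ∎
  where open ≡-Reasoning

countB-zero : ∀ (p : A → Bool) L → countB p L ≡ 0 → All (λ a → p a ≡ false) L
countB-zero p []      _ = []
countB-zero p (a ∷ L) e with p a in pa
... | false = pa ∷ countB-zero p L e

countB-suc : ∀ (p : A → Bool) L {m} → countB p L ≡ suc m → ∃ λ a → p a ≡ true
countB-suc p (a ∷ L) e with p a in pa
... | true  = a , pa
... | false = countB-suc p L e

length-filterB : ∀ (p : A → Bool) L → length (filterB p L) ≡ countB p L
length-filterB p []      = refl
length-filterB p (a ∷ L) with p a
... | true  = cong suc (length-filterB p L)
... | false = length-filterB p L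

All-filterB : ∀ {P : A → Set} (p : A → Bool) {L} → All (λ a → p a ≡ true → P a) L → All P (filterB p L)
All-filterB p {[]}    []         = []
All-filterB p {a ∷ L} (pa⇒ ∷ ps) with p a
... | true  = pa⇒ refl ∷ All-filterB p ps
... | false = All-filterB p ps

sumL-const : ∀ c (L : List A) → sumL (λ _ → c) L ≡ length L * c
sumL-const c []      = refl
sumL-const c (a ∷ L) = cong (c +_) (sumL-const c L)

AllPairs-filterB : ∀ {R : A → A → Set} (p : A → Bool) {L} →
  AllPairs (λ a b → p a ≡ true → p b ≡ true → R a b) L → AllPairs R (filterB p L)
AllPairs-filterB p {[]}    []        = []
AllPairs-filterB p {a ∷ L} (ra ∷ rs) with p a
... | true  = All-filterB p (All.map (λ r → r refl) ra) ∷ AllPairs-filterB p rs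
... | false = AllPairs-filterB p rs

Any-filterB : ∀ {P : A → Set} (p : A → Bool) {L a} → p a ≡ true → P a → a ∈ L → Any P (filterB p L)
Any-filterB p {b ∷ L} pa Pa (here refl) rewrite pa = here Pa
Any-filterB p {b ∷ L} pa Pa (there a∈L) with p b
... | true  = there (Any-filterB p pa Pa a∈L)
... | false = Any-filterB p pa Pa a∈L

==-refl : ∀ {k} (a : Fin k) → (a == a) ≡ true
==-refl a = trans (isYes≗does (a ≟ a)) (dec-true (a ≟ a) refl)

==-≢ : ∀ {k} {a b : Fin k} → ¬ a ≡ b → (a == b) ≡ false
==-≢ {a = a} {b} a≢b = trans (isYes≗does (a ≟ b)) (dec-false (a ≟ b) a≢b)

==-false : ∀ {k} {a b : Fin k} → not (a == b) ≡ true → ¬ a ≡ b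
==-false {b = b} a≢b refl with () ← trans (cong not (sym (==-refl b))) a≢b

≢⇒not== : ∀ {k} {a b : Fin k} → ¬ a ≡ b → not (a == b) ≡ true
≢⇒not== a≢b = cong not (==-≢ a≢b)

==⇒≡ : ∀ {k} {a b : Fin k} → (a == b) ≡ true → a ≡ b
==⇒≡ a==b = toWitness (Equivalence.from T-≡ a==b)

==-sym : ∀ {k} (a b : Fin k) → (a == b) ≡ (b == a)
==-sym a b =
  trans (isYes≗does (a ≟ b)) (trans (does-⇔ (mk⇔ sym sym) (a ≟ b) (b ≟ a)) (sym (isYes≗does (b ≟ a))))

suc==suc : ∀ {k} (a b : Fin k) → (_==_ {suc k} (suc a) (suc b)) ≡ (a == b)
suc==suc a b = ⌊⌋-map′ (cong suc) fsuc-injective (a ≟ b)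

sumL-pick : ∀ {m} (a : Fin m) (f : Fin m → ℕ) → sumL (λ b → (b == a) ⊙ f b) (allFin m) ≡ f a
sumL-pick {suc m} zero f = begin
  f zero + sumL (λ b → (b == zero) ⊙ f b) (tabulate {n = m} suc)  ≡⟨ cong (f zero +_) (sumL-tabulate {k = m} _ suc) ⟩
  f zero + sumL (λ _ → 0) (allFin m)                              ≡⟨ cong (f zero +_) (sumL-zero (allFin m)) ⟩
  f zero + 0                                                      ≡⟨ +-identityʳ (f zero) ⟩
  f zero                                                          ∎
  where open ≡-Reasoning
sumL-pick {suc m} (suc a) f = begin
  sumL (λ b → (b == suc a) ⊙ f b) (tabulate {n = m} suc)  ≡⟨ sumL-tabulate {k = m} _ suc ⟩
  sumL (λ b → (suc b == suc a) ⊙ f (suc b)) (allFin m)    ≡⟨ sumL-cong (λ b → cong (_⊙ f (suc b)) (suc==suc b a)) (allFin m) ⟩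
  sumL (λ b → (b == a) ⊙ f (suc b)) (allFin m)            ≡⟨ sumL-pick a (f ∘ suc) ⟩
  f (suc a)                                               ∎
  where open ≡-Reasoning

countB-== : ∀ {m} (a : Fin m) → countB (_== a) (allFin m) ≡ 1
countB-== {m} a = trans (countB≡sumL (_== a) (allFin m)) (sumL-pick a (λ _ → 1))

allB⇒All : ∀ (p : A → Bool) L → allB p L ≡ true → All (λ a → p a ≡ true) L
allB⇒All p []      _     = []
allB⇒All p (a ∷ L) pa∧ps with p a in pa
... | true = pa ∷ allB⇒All p L pa∧ps

All⇒allB : ∀ (p : A → Bool) {L} → All (λ a → p a ≡ true) L → allB p L ≡ true
All⇒allB p []         = refl
All⇒allB p (pa ∷ ps) rewrite pa = All⇒allB p ps

allB-map : ∀ (p : B → Bool) (g : A → B) L → allB p (map g L) ≡ allB (p ∘ g) L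
allB-map p g []      = refl
allB-map p g (a ∷ L) = cong (p (g a) ∧_) (allB-map p g L)

-- Pointwise equality and double counting

_≐_ : ∀ {k} {B : Fin k → ℕ} → ((i : Fin k) → Fin (B i)) → ((i : Fin k) → Fin (B i)) → Bool
_≐_ {k} f g = allB (λ i → f i == g i) (allFin k)

≐⇒≗ : ∀ {k} {B : Fin k → ℕ} {f g : (i : Fin k) → Fin (B i)} → (f ≐ g) ≡ true → ∀ i → f i ≡ g i
≐⇒≗ {k} f≐g i = ==⇒≡ (tabulate⁻ (allB⇒All _ (allFin k) f≐g) i)

≗⇒≐ : ∀ {k} {B : Fin k → ℕ} {f g : (i : Fin k) → Fin (B i)} → (∀ i → f i ≡ g i) → (f ≐ g) ≡ true
≗⇒≐ {g = g} f≗g = All⇒allB _ (tabulate⁺ (λ i → trans (cong (_== g i) (f≗g i)) (==-refl (g i))))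

≐-consΠ : ∀ {k} {B : Fin (suc k) → ℕ} a f (g : (i : Fin (suc k)) → Fin (B i)) →
  (consΠ {B = B} a f ≐ g) ≡ (a == g zero) ∧ (f ≐ (λ i → g (suc i)))
≐-consΠ {k} {B} a f g = cong ((a == g zero) ∧_)
  (trans (cong (allB p) (sym (map-tabulate id suc))) (allB-map p suc (allFin k)))
  where
  p : Fin (suc k) → Bool
  p i = consΠ {B = B} a f i == g i

countB-≐ : ∀ k (B : Fin k → ℕ) (g : (i : Fin k) → Fin (B i)) → countB (_≐ g) (allΠ k B) ≡ 1
countB-≐ zero    B g = refl
countB-≐ (suc k) B g = begin
  countB (_≐ g) (allΠ (suc k) B)
    ≡⟨ countB-concatMap (_≐ g) (λ a → map (consΠ {B = B} a) (allΠ k B′)) (allFin (B zero)) ⟩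
  sumL (λ a → countB (_≐ g) (map (consΠ {B = B} a) (allΠ k B′))) (allFin (B zero))
    ≡⟨ sumL-cong first-coordinate (allFin (B zero)) ⟩
  sumL (λ a → (a == g zero) ⊙ countB (_≐ g′) (allΠ k B′)) (allFin (B zero))
    ≡⟨ sumL-cong (λ a → cong ((a == g zero) ⊙_) (countB-≐ k B′ g′)) (allFin (B zero)) ⟩
  sumL (λ a → (a == g zero) ⊙ 1) (allFin (B zero))
    ≡⟨ sumL-pick (g zero) (λ _ → 1) ⟩
  1 ∎
  where
  open ≡-Reasoning
  B′ : Fin k → ℕ
  B′ i = B (suc i)
  g′ : (i : Fin k) → Fin (B′ i)
  g′ i = g (suc i)
  first-coordinate : ∀ a →
    countB (_≐ g) (map (consΠ {B = B} a) (allΠ k B′)) ≡ (a == g zero) ⊙ countB (_≐ g′) (allΠ k B′)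
  first-coordinate a = begin
    countB (_≐ g) (map (consΠ {B = B} a) (allΠ k B′))     ≡⟨ countB-map (_≐ g) (consΠ {B = B} a) (allΠ k B′) ⟩
    countB (λ f → consΠ {B = B} a f ≐ g) (allΠ k B′)      ≡⟨ countB-cong (λ f → ≐-consΠ {B = B} a f g) (allΠ k B′) ⟩
    countB (λ f → (a == g zero) ∧ (f ≐ g′)) (allΠ k B′)   ≡⟨ countB-∧ˡ (a == g zero) (_≐ g′) (allΠ k B′) ⟩
    (a == g zero) ⊙ countB (_≐ g′) (allΠ k B′)            ∎

double-counting : ∀ (R : A → B → Bool) {p : A → Bool} {q : B → Bool} L₁ L₂ {k l} →
  All (λ a → countB (R a) L₂ ≡ k) L₁ → All (λ b → countB (λ a → R a b) L₁ ≡ l) L₂ →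
  (∀ a b → R a b ≡ true → p a ≡ q b) → countB p L₁ * k ≡ countB q L₂ * l
double-counting R {p} {q} L₁ L₂ {k} {l} deg₁ deg₂ R⇒p≡q = begin
  countB p L₁ * k
    ≡⟨ countB-*ʳ p k L₁ ⟩
  sumL (λ a → p a ⊙ k) L₁
    ≡⟨ sumL-congᴬ (All.map (λ d → cong (p _ ⊙_) (sym d)) deg₁) ⟩
  sumL (λ a → p a ⊙ countB (R a) L₂) L₁
    ≡⟨ sumL-cong (λ a → ⊙-countB (p a) (R a) L₂) L₁ ⟩
  sumL (λ a → sumL (λ b → (p a ∧ R a b) ⊙ 1) L₂) L₁
    ≡⟨ sumL-cong (λ a → sumL-cong (λ b → cong (_⊙ 1) (transfer a b)) L₂) L₁ ⟩
  sumL (λ a → sumL (λ b → (q b ∧ R a b) ⊙ 1) L₂) L₁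
    ≡⟨ sumL-swap (λ a b → (q b ∧ R a b) ⊙ 1) L₁ L₂ ⟩
  sumL (λ b → sumL (λ a → (q b ∧ R a b) ⊙ 1) L₁) L₂
    ≡⟨ sumL-cong (λ b → sym (⊙-countB (q b) (λ a → R a b) L₁)) L₂ ⟩
  sumL (λ b → q b ⊙ countB (λ a → R a b) L₁) L₂
    ≡⟨ sumL-congᴬ (All.map (λ d → cong (q _ ⊙_) d) deg₂) ⟩
  sumL (λ b → q b ⊙ l) L₂
    ≡⟨ sym (countB-*ʳ q l L₂) ⟩
  countB q L₂ * l ∎
  where
  open ≡-Reasoning
  ⊙-countB : ∀ {C : Set} b (r : C → Bool) L → b ⊙ countB r L ≡ sumL (λ c → (b ∧ r c) ⊙ 1) L
  ⊙-countB b r L = trans (sym (countB-∧ˡ b r L)) (countB≡sumL _ L)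
  transfer : ∀ a b → (p a ∧ R a b) ≡ (q b ∧ R a b)
  transfer a b with R a b in Rab
  ... | true  = cong (_∧ true) (R⇒p≡q a b Rab)
  ... | false = trans (∧-zeroʳ (p a)) (sym (∧-zeroʳ (q b)))

countB-bijective : ∀ (R : A → B → Bool) {p : A → Bool} {q : B → Bool} L₁ L₂ →
  All (λ a → countB (R a) L₂ ≡ 1) L₁ → All (λ b → countB (λ a → R a b) L₁ ≡ 1) L₂ →
  (∀ a b → R a b ≡ true → p a ≡ q b) → countB p L₁ ≡ countB q L₂
countB-bijective R L₁ L₂ deg₁ deg₂ R⇒p≡q =
  trans (sym (*-identityʳ _)) (trans (double-counting R L₁ L₂ deg₁ deg₂ R⇒p≡q) (*-identityʳ _))

countB-∘-bijection : ∀ {a b m} (τ : Fin a → Fin b) (τ⁻¹ : Fin b → Fin a) →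
  (∀ i → τ (τ⁻¹ i) ≡ i) → (∀ j → τ⁻¹ (τ j) ≡ j) →
  (P : (Fin a → Fin m) → Bool) → (∀ {y z} → (∀ i → y i ≡ z i) → P y ≡ P z) →
  countB (λ x → P (x ∘ τ)) (allFuns b m) ≡ countB P (allFuns a m)
countB-∘-bijection {a} {b} {m} τ τ⁻¹ τ∘τ⁻¹ τ⁻¹∘τ P P-resp =
  countB-bijective (λ x y → y ≐ (x ∘ τ)) (allFuns b m) (allFuns a m)
    (All.universal (λ x → countB-≐ a _ (x ∘ τ)) _)
    (All.universal (λ y → trans (countB-cong (transpose y) (allFuns b m)) (countB-≐ b _ (y ∘ τ⁻¹))) _)
    (λ x y y≐x∘τ → P-resp (λ i → sym (≐⇒≗ y≐x∘τ i)))
  where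
  transpose : ∀ y x → (y ≐ (x ∘ τ)) ≡ (x ≐ (y ∘ τ⁻¹))
  transpose y x = ⇔→≡ (mk⇔
    (λ e → ≗⇒≐ (λ j → trans (cong x (sym (τ∘τ⁻¹ j))) (sym (≐⇒≗ e (τ⁻¹ j)))))
    (λ e → ≗⇒≐ (λ i → trans (cong y (sym (τ⁻¹∘τ i))) (sym (≐⇒≗ e (τ i))))))

-- Multigraphs

_≈_ : ∀ {n} → Edges n → Edges n → Set
E ≈ E′ = ∀ a b → mult E a b ≡ mult E′ a b

countB-∷-cong : ∀ (p : A → Bool) a {L M} → countB p L ≡ countB p M → countB p (a ∷ L) ≡ countB p (a ∷ M)
countB-∷-cong p a L≡M with p a
... | true  = cong suc L≡M
... | false = L≡M

countB-∷-swap : ∀ (p : A → Bool) a b L → countB p (a ∷ b ∷ L) ≡ countB p (b ∷ a ∷ L)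
countB-∷-swap p a b L with p a | p b
... | true  | true  = refl
... | true  | false = refl
... | false | true  = refl
... | false | false = refl

≈-cons : ∀ {n} e {E E′ : Edges n} → E ≈ E′ → (e ∷ E) ≈ (e ∷ E′)
≈-cons e {E} {E′} E≈E′ a b = countB-∷-cong (λ d → endpointsAre d a b) e {E} {E′} (E≈E′ a b)

≈-swap : ∀ {n} e e′ (E : Edges n) → (e ∷ e′ ∷ E) ≈ (e′ ∷ e ∷ E)
≈-swap e e′ E a b = countB-∷-swap (λ d → endpointsAre d a b) e e′ E

≈-flip : ∀ {n} (u v : Fin n) E → ((u , v) ∷ E) ≈ ((v , u) ∷ E)
≈-flip u v E a b = cong (λ c → if c then suc (mult E a b) else mult E a b)
  (trans (∨-comm (u == a ∧ v == b) _) (cong₂ _∨_ (∧-comm (u == b) (v == a)) (∧-comm (u == a) (v == b))))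

≈-mid : ∀ {n} (P : Edges n) e E → (P ++ e ∷ E) ≈ (e ∷ P ++ E)
≈-mid []      e E a b = refl
≈-mid (d ∷ P) e E a b = trans (≈-cons d {P ++ e ∷ E} {e ∷ P ++ E} (≈-mid P e E) a b) (≈-swap d e (P ++ E) a b)

sameGraph-resp : ∀ {n} (H : Edges n) {E E′} → E ≈ E′ → sameGraph E H ≡ sameGraph E′ H
sameGraph-resp {n} H E≈E′ =
  allB-cong (λ ab → cong (_≡ᵇ mult H (proj₁ ab) (proj₂ ab)) (E≈E′ (proj₁ ab) (proj₂ ab)))
            (allPairs (allFin n) (allFin n))
  where
  allB-cong : ∀ {p q : A → Bool} → (∀ a → p a ≡ q a) → ∀ L → allB p L ≡ allB q L
  allB-cong p≗q []      = refl
  allB-cong p≗q (a ∷ L) = cong₂ _∧_ (p≗q a) (allB-cong p≗q L)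

-- Pairings of [N]

Pairing : ℕ → Set
Pairing N = List (Fin N × Fin N)

pairEdges : ∀ {N n} → (Fin N → Fin n) → Pairing N → Edges n
pairEdges x = map (λ q → x (proj₁ q) , x (proj₂ q))

select : Fin 2 → A × A → A
select zero    = proj₁
select (suc _) = proj₂

Apart : ∀ {N} → Fin N × Fin N → Fin N × Fin N → Set
Apart q q′ = ∀ b b′ → ¬ select b q ≡ select b′ q′

Disjoint : ∀ {N} → Pairing N → Set
Disjoint p = All (λ q → ¬ proj₁ q ≡ proj₂ q) p × AllPairs Apart p

Covers : ∀ {N} → Pairing N → Set
Covers {N} p = ∀ (c : Fin N) → Any (λ q → ∃ λ b → select b q ≡ c) p

endpoint : ∀ {N} (p : Pairing N) → Fin (length p * 2) → Fin N
endpoint p i = select (proj₂ (remQuot {length p} 2 i)) (lookup p (proj₁ (remQuot {length p} 2 i)))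

endpoint-combine : ∀ {N} (p : Pairing N) t b → endpoint p (combine t b) ≡ select b (lookup p t)
endpoint-combine p t b =
  cong (λ r → select (proj₂ r) (lookup p (proj₁ r))) (remQuot-combine {length p} {2} t b)

select-injective : ∀ {q : A × A} → ¬ proj₁ q ≡ proj₂ q → ∀ b b′ → select b q ≡ select b′ q → b ≡ b′
select-injective loop-free zero       zero       _ = refl
select-injective loop-free zero       (suc zero) e = ⊥-elim (loop-free e)
select-injective loop-free (suc zero) zero       e = ⊥-elim (loop-free (sym e))
select-injective loop-free (suc zero) (suc zero) _ = refl

select-lookup-injective : ∀ {N} {p : Pairing N} → Disjoint p → ∀ t t′ b b′ →
  select b (lookup p t) ≡ select b′ (lookup p t′) → t ≡ t′ × b ≡ b′
select-lookup-injective (lf ∷ _ , _) zero zero b b′ e = refl , select-injective lf b b′ e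
select-lookup-injective {p = _ ∷ p} (_ , apart ∷ _) zero (suc u) b b′ e =
  ⊥-elim (All.lookup apart (∈-lookup {xs = p} u) b b′ e)
select-lookup-injective {p = _ ∷ p} (_ , apart ∷ _) (suc u) zero b b′ e =
  ⊥-elim (All.lookup apart (∈-lookup {xs = p} u) b′ b (sym e))
select-lookup-injective (_ ∷ lfs , _ ∷ aps) (suc u) (suc u′) b b′ e =
  let u≡u′ , b≡b′ = select-lookup-injective (lfs , aps) u u′ b b′ e in cong suc u≡u′ , b≡b′

endpoint-injective : ∀ {N} {p : Pairing N} → Disjoint p → ∀ {i i′} → endpoint p i ≡ endpoint p i′ → i ≡ i′
endpoint-injective {p = p} disjoint {i} {i′} e = begin
  i              ≡⟨ sym (combine-remQuot {length p} 2 i) ⟩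
  combine t b    ≡⟨ cong₂ combine (proj₁ same) (proj₂ same) ⟩
  combine t′ b′  ≡⟨ combine-remQuot {length p} 2 i′ ⟩
  i′             ∎
  where
  open ≡-Reasoning
  t  = proj₁ (remQuot {length p} 2 i)
  b  = proj₂ (remQuot {length p} 2 i)
  t′ = proj₁ (remQuot {length p} 2 i′)
  b′ = proj₂ (remQuot {length p} 2 i′)
  same = select-lookup-injective disjoint t t′ b b′ e

endpoint-surjective : ∀ {N} {p : Pairing N} → Covers p → ∀ c → ∃ λ i → endpoint p i ≡ c
endpoint-surjective {p = p} covers c =
  combine t b , trans (endpoint-combine p t b) (proj₂ (lookup-index (covers c)))
  where
  t = Any.index (covers c)
  b = proj₁ (lookup-index (covers c))

adjacentPairs : ∀ {n} k → (Fin (k * 2) → Fin n) → Edges n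
adjacentPairs k x = map (λ t → x (combine t zero) , x (combine t (suc zero))) (allFin k)

adjacentPairs-cong : ∀ {n} k {y z : Fin (k * 2) → Fin n} → (∀ i → y i ≡ z i) → adjacentPairs k y ≡ adjacentPairs k z
adjacentPairs-cong k y≗z = map-cong (λ t → cong₂ _,_ (y≗z _) (y≗z _)) (allFin k)

adjacentPairs-endpoint : ∀ {N n} (p : Pairing N) (x : Fin N → Fin n) →
  adjacentPairs (length p) (x ∘ endpoint p) ≡ pairEdges x p
adjacentPairs-endpoint p x = begin
  adjacentPairs (length p) (x ∘ endpoint p)
    ≡⟨ map-cong (λ t → cong₂ _,_ (cong x (endpoint-combine p t zero)) (cong x (endpoint-combine p t (suc zero))))
                (allFin (length p)) ⟩
  map (edge ∘ lookup p) (allFin (length p))   ≡⟨ map-tabulate id (edge ∘ lookup p) ⟩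
  tabulate (edge ∘ lookup p)                  ≡⟨ sym (map-tabulate (lookup p) edge) ⟩
  map edge (tabulate (lookup p))              ≡⟨ cong (map edge) (tabulate-lookup p) ⟩
  map edge p                                  ∎
  where
  open ≡-Reasoning
  edge : _ × _ → _ × _
  edge q = x (proj₁ q) , x (proj₂ q)

-- Perfect matchings

lowerEnd : ∀ {N} → (Fin N → Fin N) → Fin N → Bool
lowerEnd M i = toℕ i <ᵇ toℕ (M i)

matchingPairing : ∀ {N} → (Fin N → Fin N) → Pairing N
matchingPairing {N} M = map (λ i → i , M i) (filterB (lowerEnd M) (allFin N))

module _ {N} {M : Fin N → Fin N} (involutive : ∀ i → M (M i) ≡ i) (fixed-point-free : ∀ i → ¬ M i ≡ i) where

  private
    lower⇒< : ∀ {i} → lowerEnd M i ≡ true → toℕ i < toℕ (M i)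
    lower⇒< {i} e = <ᵇ⇒< (toℕ i) _ (Equivalence.from T-≡ e)

    <⇒lower : ∀ {i} → toℕ i < toℕ (M i) → lowerEnd M i ≡ true
    <⇒lower i<Mi = Equivalence.to T-≡ (<⇒<ᵇ i<Mi)

    not-crossing : ∀ {i l} → lowerEnd M i ≡ true → lowerEnd M l ≡ true → ¬ M i ≡ l
    not-crossing {i} {l} li ll Mi≡l = <-asym (subst (λ z → toℕ i < toℕ z) Mi≡l (lower⇒< li))
                                             (subst (λ z → toℕ l < toℕ z) Ml≡i (lower⇒< ll))
      where
      Ml≡i : M l ≡ i
      Ml≡i = trans (cong M (sym Mi≡l)) (involutive i)

    lower-apart : ∀ {i l} → ¬ i ≡ l → lowerEnd M i ≡ true → lowerEnd M l ≡ true → Apart (i , M i) (l , M l)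
    lower-apart i≢l li ll zero       zero       e = i≢l e
    lower-apart i≢l li ll zero       (suc zero) e = not-crossing ll li (sym e)
    lower-apart i≢l li ll (suc zero) zero       e = not-crossing li ll e
    lower-apart i≢l li ll (suc zero) (suc zero) e = i≢l (trans (sym (involutive _)) (trans (cong M e) (involutive _)))

    partner-lower : ∀ c → lowerEnd M c ≡ false → lowerEnd M (M c) ≡ true
    partner-lower c lc = <⇒lower (subst (λ z → toℕ (M c) < toℕ z) (sym (involutive c)) Mc<c)
      where
      c≮Mc : ¬ toℕ c < toℕ (M c)
      c≮Mc c<Mc with () ← trans (sym lc) (<⇒lower c<Mc)
      Mc<c : toℕ (M c) < toℕ c
      Mc<c = ≤∧≢⇒< (≮⇒≥ c≮Mc) (fixed-point-free c ∘ toℕ-injective)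

  matchingPairing-disjoint : Disjoint (matchingPairing M)
  matchingPairing-disjoint =
    Allₚ.map⁺ (All-filterB (lowerEnd M) (All.universal (λ i li → <⇒≢ (lower⇒< li) ∘ cong toℕ) (allFin N))) ,
    AllPairsₚ.map⁺ (AllPairs-filterB (lowerEnd M) (AllPairs.map lower-apart (allFin⁺ N)))

  matchingPairing-covers : Covers (matchingPairing M)
  matchingPairing-covers c with lowerEnd M c in lc
  ... | true  = Anyₚ.map⁺ (Any-filterB (lowerEnd M) lc (zero , refl) (∈-allFin c))
  ... | false = Anyₚ.map⁺ (Any-filterB (lowerEnd M) (partner-lower c lc) (suc zero , involutive c) (∈-allFin (M c)))

perfectMatching-perfect : ∀ {N} {M : Fin N → Fin N} → isPerfectMatching M ≡ true →
  Disjoint (matchingPairing M) × Covers (matchingPairing M)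
perfectMatching-perfect {N} {M} pm =
  matchingPairing-disjoint involutive fixed-point-free , matchingPairing-covers involutive fixed-point-free
  where
  laws : ∀ i → (M (M i) == i ∧ not (M i == i)) ≡ true
  laws = tabulate⁻ (allB⇒All _ (allFin N) pm)
  involutive : ∀ i → M (M i) ≡ i
  involutive i = ==⇒≡ (proj₁ (∧-true (laws i)))
  fixed-point-free : ∀ i → ¬ M i ≡ i
  fixed-point-free i = ==-false (proj₂ (∧-true {M (M i) == i} (laws i)))

-- Matching [N] one pair at a time

unmatched : ∀ {N} → Subset N → Fin N → Bool
unmatched s k = not (Vec.lookup s k)

free : ∀ {N} → Subset N → Fin N → Fin N → Bool
free s i j = unmatched s j ∧ not (j == i)

match : ∀ {N} → Subset N → Fin N → Fin N → Subset N
match s i j = s ∪ ⁅ i ⁆ ∪ ⁅ j ⁆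

#unmatched : ∀ {N} → Subset N → ℕ
#unmatched {N} s = countB (unmatched s) (allFin N)

Valid : ∀ {N} → (Subset N → Fin N) → Set
Valid π = ∀ s → (∃[ j ] Vec.lookup s j ≡ false) → Vec.lookup s (π s) ≡ false

lookup-⁅⁆ : ∀ {N} (i k : Fin N) → Vec.lookup ⁅ i ⁆ k ≡ (k == i)
lookup-⁅⁆ zero    zero    = refl
lookup-⁅⁆ zero    (suc k) = lookup-replicate k false
lookup-⁅⁆ (suc i) zero    = refl
lookup-⁅⁆ (suc i) (suc k) = trans (lookup-⁅⁆ i k) (sym (suc==suc k i))

unmatched-match : ∀ {N} (s : Subset N) i j k → unmatched (match s i j) k ≡ free s i k ∧ not (k == j)
unmatched-match s i j k
  rewrite lookup-zipWith _∨_ k s (⁅ i ⁆ ∪ ⁅ j ⁆) | lookup-zipWith _∨_ k ⁅ i ⁆ ⁅ j ⁆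
        | lookup-⁅⁆ i k | lookup-⁅⁆ j k
  = de-morgan (Vec.lookup s k) (k == i) (k == j)
  where
  de-morgan : ∀ a b c → not (a ∨ b ∨ c) ≡ (not a ∧ not b) ∧ not c
  de-morgan true  b     c = refl
  de-morgan false true  c = refl
  de-morgan false false c = refl

free-intro : ∀ {N} (s : Subset N) {i j} → unmatched s j ≡ true → ¬ j ≡ i → free s i j ≡ true
free-intro s uj j≢i = ∧-intro uj (≢⇒not== j≢i)

unmatched-match⁺ : ∀ {N} (s : Subset N) {i j c} → unmatched s c ≡ true → ¬ c ≡ i → ¬ c ≡ j →
  unmatched (match s i j) c ≡ true
unmatched-match⁺ s {i} {j} {c} uc c≢i c≢j =
  trans (unmatched-match s i j c) (∧-intro (free-intro s uc c≢i) (≢⇒not== c≢j))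

match-comm : ∀ {N} (s : Subset N) i j → match s i j ≡ match s j i
match-comm s i j = cong (s ∪_) (∪-comm ⁅ i ⁆ ⁅ j ⁆)

match-match-comm : ∀ {N} (s : Subset N) i j i′ j′ → match (match s i j) i′ j′ ≡ match (match s i′ j′) i j
match-match-comm s i j i′ j′ = begin
  (s ∪ P) ∪ Q   ≡⟨ ∪-assoc s P Q ⟩
  s ∪ P ∪ Q     ≡⟨ cong (s ∪_) (∪-comm P Q) ⟩
  s ∪ Q ∪ P     ≡⟨ sym (∪-assoc s Q P) ⟩
  (s ∪ Q) ∪ P   ∎
  where
  open ≡-Reasoning
  P = ⁅ i ⁆ ∪ ⁅ j ⁆
  Q = ⁅ i′ ⁆ ∪ ⁅ j′ ⁆

countB-remove : ∀ {N} (u : Fin N → Bool) i → u i ≡ true →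
  countB (λ k → u k ∧ not (k == i)) (allFin N) + 1 ≡ countB u (allFin N)
countB-remove {N} u i ui = sym (begin
  countB u (allFin N)
    ≡⟨ countB-split u (_== i) (allFin N) ⟩
  countB (λ k → u k ∧ (k == i)) (allFin N) + countB (λ k → u k ∧ not (k == i)) (allFin N)
    ≡⟨ cong (_+ countB (λ k → u k ∧ not (k == i)) (allFin N)) (trans (countB-cong only-i (allFin N)) (countB-== i)) ⟩
  1 + countB (λ k → u k ∧ not (k == i)) (allFin N)
    ≡⟨ +-comm 1 _ ⟩
  countB (λ k → u k ∧ not (k == i)) (allFin N) + 1 ∎)
  where
  open ≡-Reasoning
  only-i : ∀ k → (u k ∧ (k == i)) ≡ (k == i)
  only-i k = ⇔→≡ (mk⇔ (proj₂ ∘ ∧-true) (λ k==i → ∧-intro (trans (cong u (==⇒≡ k==i)) ui) k==i))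

#unmatched-match : ∀ {N} (s : Subset N) {i j} → unmatched s i ≡ true → free s i j ≡ true →
  #unmatched (match s i j) + 2 ≡ #unmatched s
#unmatched-match {N} s {i} {j} ui fj = begin
  #unmatched (match s i j) + 2                             ≡⟨ cong (_+ 2) (countB-cong (unmatched-match s i j) (allFin N)) ⟩
  countB (λ k → free s i k ∧ not (k == j)) (allFin N) + 2  ≡⟨ sym (+-assoc _ 1 1) ⟩
  countB (λ k → free s i k ∧ not (k == j)) (allFin N) + 1 + 1  ≡⟨ cong (_+ 1) (countB-remove (free s i) j fj) ⟩
  countB (free s i) (allFin N) + 1                         ≡⟨ countB-remove (unmatched s) i ui ⟩
  #unmatched s                                             ∎
  where open ≡-Reasoning

#unmatched-step : ∀ {N} (s : Subset N) i j r → #unmatched s ≡ suc r * 2 → unmatched s i ≡ true → free s i j ≡ true →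
  #unmatched (match s i j) ≡ r * 2
#unmatched-step s i j r us ui fj = +-cancelʳ-≡ 2 _ _ (trans (#unmatched-match s ui fj) (trans us (+-comm 2 (r * 2))))

#unmatched-∅ : ∀ N → #unmatched (∅ {N}) ≡ N
#unmatched-∅ N = begin
  countB (unmatched ∅) (allFin N)  ≡⟨ countB-cong (λ k → cong not (lookup-replicate k false)) (allFin N) ⟩
  countB (λ _ → true) (allFin N)   ≡⟨ countB-true (allFin N) ⟩
  length (allFin N)                ≡⟨ length-tabulate id ⟩
  N                                ∎
  where open ≡-Reasoning

length-free : ∀ {N} (s : Subset N) {i} → unmatched s i ≡ true → length (filterB (free s i) (allFin N)) + 1 ≡ #unmatched s
length-free {N} s {i} ui = trans (cong (_+ 1) (length-filterB (free s i) (allFin N))) (countB-remove (unmatched s) i ui)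

valid-unmatched : ∀ {N} {π : Subset N → Fin N} → Valid π → ∀ s {m} → #unmatched s ≡ suc m →
  unmatched s (π s) ≡ true
valid-unmatched valid s e =
  let j , uj = countB-suc (unmatched s) (allFin _) e in cong not (valid s (j , not-injective uj))

pair-guard-sym : ∀ {N} (s : Subset N) i i′ a b →
  (free s i a ∧ not (a == i′)) ∧ free (match s i a) i′ b ≡ (free s i′ b ∧ not (b == i)) ∧ free (match s i′ b) i a
pair-guard-sym s i i′ a b rewrite unmatched-match s i a b | unmatched-match s i′ b a | ==-sym a b =
  ∧-ac (unmatched s a) (unmatched s b) (not (a == i)) (not (a == i′)) (not (b == i)) (not (b == i′)) (not (b == a))
  where
  ∧-ac : ∀ ua ub ai ai′ bi bi′ ab →
    ((ua ∧ ai) ∧ ai′) ∧ (((ub ∧ bi) ∧ ab) ∧ bi′) ≡ ((ub ∧ bi′) ∧ bi) ∧ (((ua ∧ ai′) ∧ ab) ∧ ai)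
  ∧-ac = solve 7 (λ ua ub ai ai′ bi bi′ ab →
    ((ua ⊕ ai) ⊕ ai′) ⊕ (((ub ⊕ bi) ⊕ ab) ⊕ bi′) ⊜ ((ub ⊕ bi′) ⊕ bi) ⊕ (((ua ⊕ ai′) ⊕ ab) ⊕ ai)) refl

prefer : ∀ {N} → Fin N → (Subset N → Fin N) → Subset N → Fin N
prefer i π s = if Vec.lookup s i then π s else i

prefer-valid : ∀ {N} i {π : Subset N → Fin N} → Valid π → Valid (prefer i π)
prefer-valid i valid s ∃unmatched with Vec.lookup s i in si
... | true  = valid s ∃unmatched
... | false = si

prefer-unmatched : ∀ {N} {i} (π : Subset N → Fin N) s → unmatched s i ≡ true → prefer i π s ≡ i
prefer-unmatched {i = i} π s ui rewrite not-injective {y = false} ui = refl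

paths : ∀ {N} → (Subset N → Fin N) → ℕ → Subset N → List (Pairing N)
paths π zero    s = [ [] ]
paths {N} π (suc r) s =
  concatMap (λ j → map ((π s , j) ∷_) (paths π r (match s (π s) j))) (filterB (free s (π s)) (allFin N))

Within : ∀ {N} → Subset N → Pairing N → Set
Within s = All (λ q → ∀ b → unmatched s (select b q) ≡ true)

CoversUnmatched : ∀ {N} → Subset N → Pairing N → Set
CoversUnmatched s p = ∀ c → unmatched s c ≡ true → Any (λ q → ∃ λ b → select b q ≡ c) p

PerfectOn : ∀ {N} → Subset N → Pairing N → Set
PerfectOn s p = Disjoint p × Within s p × CoversUnmatched s p

unmatched-match⁻ : ∀ {N} (s : Subset N) i j {c} → unmatched (match s i j) c ≡ true →
  unmatched s c ≡ true × ¬ c ≡ i × ¬ c ≡ j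
unmatched-match⁻ s i j {c} uc =
  proj₁ (∧-true fc) , ==-false (proj₂ (∧-true {unmatched s c} fc)) , ==-false c≢j
  where
  after : (free s i c ∧ not (c == j)) ≡ true
  after = trans (sym (unmatched-match s i j c)) uc
  fc : free s i c ≡ true
  fc = proj₁ (∧-true after)
  c≢j : not (c == j) ≡ true
  c≢j = proj₂ (∧-true {free s i c} after)

perfect-∷ : ∀ {N} (s : Subset N) i j {p} → unmatched s i ≡ true → free s i j ≡ true →
  PerfectOn (match s i j) p → PerfectOn s ((i , j) ∷ p)
perfect-∷ s i j {p} ui fj ((loop-free , apart) , within , covers) =
  ((j≢i ∘ sym ∷ loop-free) , (All.map apart-from-ij within ∷ apart)) ,
  (head-within ∷ All.map (λ w b → proj₁ (unmatched-match⁻ s i j (w b))) within) ,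
  covers′
  where
  j≢i : ¬ j ≡ i
  j≢i = ==-false (proj₂ (∧-true {unmatched s j} fj))
  head-within : ∀ b → unmatched s (select b (i , j)) ≡ true
  head-within zero       = ui
  head-within (suc zero) = proj₁ (∧-true fj)
  apart-from-ij : ∀ {q} → (∀ b → unmatched (match s i j) (select b q) ≡ true) → Apart (i , j) q
  apart-from-ij w zero       b′ e = proj₁ (proj₂ (unmatched-match⁻ s i j (w b′))) (sym e)
  apart-from-ij w (suc zero) b′ e = proj₂ (proj₂ (unmatched-match⁻ s i j (w b′))) (sym e)
  covers′ : CoversUnmatched s ((i , j) ∷ p)
  covers′ c uc with c ≟ i | c ≟ j
  ... | yes c≡i | _       = here (zero , sym c≡i)
  ... | no _    | yes c≡j = here (suc zero , sym c≡j)
  ... | no c≢i  | no c≢j  =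
    there (covers c (unmatched-match⁺ s uc c≢i c≢j))

paths-perfect : ∀ {N} {π : Subset N → Fin N} → Valid π → ∀ r s → #unmatched s ≡ r * 2 →
  All (PerfectOn s) (paths π r s)
paths-perfect {N} vπ zero s us = ((([] , []) , [] , nothing-unmatched)) ∷ []
  where
  nothing-unmatched : CoversUnmatched s []
  nothing-unmatched c uc with () ← trans (sym uc) (tabulate⁻ (countB-zero (unmatched s) (allFin N) us) c)
paths-perfect {N} {π} vπ (suc r) s us = Allₚ.concat⁺ (Allₚ.map⁺ (All-filterB (free s i) (All.universal extend (allFin N))))
  where
  i = π s
  ui = valid-unmatched vπ s us
  extend : ∀ j → free s i j ≡ true → All (PerfectOn s) (map ((i , j) ∷_) (paths π r (match s i j)))
  extend j fj = Allₚ.map⁺ (All.map (perfect-∷ s i j ui fj)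
    (paths-perfect vπ r (match s i j) (#unmatched-step s i j r us ui fj)))

-- The adaptive process

module Runs {n} (F : Edges n → Bool) (F-resp : ∀ {E E′} → E ≈ E′ → F E ≡ F E′) (x : Xs n) where

  private
    N = n * 2

  #accepted : (Subset N → Fin N) → ℕ → Subset N → Edges n → ℕ
  branch : (Subset N → Fin N) → ℕ → Subset N → Edges n → Fin N → ℕ

  #accepted π zero    s E = F E ⊙ 1
  #accepted π (suc r) s E = branch π r s E (π s)

  branch π r s E i = sumL (λ j → free s i j ⊙ #accepted π r (match s i j) ((x i , x j) ∷ E)) (allFin N)

  #accepted-resp : ∀ π r s {E E′} → E ≈ E′ → #accepted π r s E ≡ #accepted π r s E′
  #accepted-resp π zero    s E≈E′ = cong (_⊙ 1) (F-resp E≈E′)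
  #accepted-resp π (suc r) s {E} {E′} E≈E′ =
    sumL-cong (λ j → cong (free s i j ⊙_) (#accepted-resp π r _ (≈-cons (x i , x j) {E} {E′} E≈E′))) (allFin N)
    where i = π s

  Independent : ℕ → Set
  Independent r = ∀ {π π′} s E → Valid π → Valid π′ → #unmatched s ≡ r * 2 →
    #accepted π r s E ≡ #accepted π′ r s E

  branch-strategy : ∀ r s E i {π π′} → Independent r → Valid π → Valid π′ →
    #unmatched s ≡ suc r * 2 → unmatched s i ≡ true → branch π r s E i ≡ branch π′ r s E i
  branch-strategy r s E i independent vπ vπ′ us ui = sumL-cong
    (λ j → ⊙-cong (free s i j) (λ fj → independent _ _ vπ vπ′ (#unmatched-step s i j r us ui fj))) (allFin N)

  branchAvoiding : (Subset N → Fin N) → ℕ → Subset N → Edges n → Fin N → Fin N → ℕ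
  branchAvoiding ρ r s E i i′ =
    sumL (λ j → (free s i j ∧ not (j == i′)) ⊙ #accepted ρ r (match s i j) ((x i , x j) ∷ E)) (allFin N)

  branch-split : ∀ ρ r s E {i i′} → free s i i′ ≡ true →
    branch ρ r s E i ≡ #accepted ρ r (match s i i′) ((x i , x i′) ∷ E) + branchAvoiding ρ r s E i i′
  branch-split ρ r s E {i} {i′} fi′ = begin
    sumL (λ j → free s i j ⊙ t j) (allFin N)
      ≡⟨ sumL-cong (λ j → ⊙-split (free s i j) (j == i′) (t j)) (allFin N) ⟩
    sumL (λ j → (free s i j ∧ (j == i′)) ⊙ t j + (free s i j ∧ not (j == i′)) ⊙ t j) (allFin N)
      ≡⟨ sumL-+ _ _ (allFin N) ⟩
    sumL (λ j → (free s i j ∧ (j == i′)) ⊙ t j) (allFin N) + branchAvoiding ρ r s E i i′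
      ≡⟨ cong (_+ branchAvoiding ρ r s E i i′)
              (trans (sumL-cong (λ j → cong (_⊙ t j) (only-i′ j)) (allFin N)) (sumL-pick i′ t)) ⟩
    t i′ + branchAvoiding ρ r s E i i′ ∎
    where
    open ≡-Reasoning
    t : Fin N → ℕ
    t j = #accepted ρ r (match s i j) ((x i , x j) ∷ E)
    only-i′ : ∀ j → (free s i j ∧ (j == i′)) ≡ (j == i′)
    only-i′ j = ⇔→≡ (mk⇔ (proj₂ ∘ ∧-true)
                         (λ j==i′ → ∧-intro (trans (cong (free s i) (==⇒≡ j==i′)) fi′) j==i′))

  branchAvoiding-zero : ∀ ρ s E {i i′} → #unmatched s ≡ 2 → unmatched s i ≡ true → free s i i′ ≡ true →
    branchAvoiding ρ 0 s E i i′ ≡ 0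
  branchAvoiding-zero ρ s E {i} {i′} us ui fi′ = sumL-zeroᴬ (All.map (cong (_⊙ _)) (countB-zero _ (allFin N) none))
    where
    none : countB (λ j → free s i j ∧ not (j == i′)) (allFin N) ≡ 0
    none = +-cancelʳ-≡ 1 _ 0 (trans (countB-remove (free s i) i′ fi′)
                                (+-cancelʳ-≡ 1 _ 1 (trans (countB-remove (unmatched s) i ui) us)))

  twoRounds : (Subset N → Fin N) → ℕ → Subset N → Edges n → Fin N → Fin N → Fin N → Fin N → ℕ
  twoRounds ρ r s E i i′ a b = ((free s i a ∧ not (a == i′)) ∧ free (match s i a) i′ b)
    ⊙ #accepted ρ r (match (match s i a) i′ b) ((x i′ , x b) ∷ (x i , x a) ∷ E)

  branchAvoiding-expand : ∀ ρ r s E {i i′} → (∀ S → unmatched S i′ ≡ true → ρ S ≡ i′) →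
    unmatched s i′ ≡ true → ¬ i ≡ i′ →
    branchAvoiding ρ (suc r) s E i i′ ≡ sumL (λ a → sumL (λ b → twoRounds ρ r s E i i′ a b) (allFin N)) (allFin N)
  branchAvoiding-expand ρ r s E {i} {i′} ρ-prefers ui′ i≢i′ = sumL-cong second-round (allFin N)
    where
    second-round : ∀ a → (free s i a ∧ not (a == i′)) ⊙ #accepted ρ (suc r) (match s i a) ((x i , x a) ∷ E)
                         ≡ sumL (λ b → twoRounds ρ r s E i i′ a b) (allFin N)
    second-round a = begin
      g ⊙ branch ρ r (match s i a) ((x i , x a) ∷ E) (ρ (match s i a))
        ≡⟨ ⊙-cong g (λ ga → cong (branch ρ r (match s i a) ((x i , x a) ∷ E)) (ρ-prefers _ (i′-unmatched ga))) ⟩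
      g ⊙ branch ρ r (match s i a) ((x i , x a) ∷ E) i′
        ≡⟨ sumL-⊙ g _ (allFin N) ⟩
      sumL (λ b → g ⊙ (free (match s i a) i′ b ⊙ _)) (allFin N)
        ≡⟨ sumL-cong (λ b → ⊙-∧ g _ _) (allFin N) ⟩
      sumL (λ b → twoRounds ρ r s E i i′ a b) (allFin N) ∎
      where
      open ≡-Reasoning
      g = free s i a ∧ not (a == i′)
      i′-unmatched : g ≡ true → unmatched (match s i a) i′ ≡ true
      i′-unmatched ga = unmatched-match⁺ s ui′ (i≢i′ ∘ sym) (==-false (proj₂ (∧-true {free s i a} ga)) ∘ sym)

  mutual
    independent : ∀ r → Independent r
    independent zero    s E vπ vπ′ us = refl
    independent (suc r) {π} {π′} s E vπ vπ′ us with π s ≟ π′ s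
    ... | yes πs≡π′s =
      trans (branch-strategy r s E (π s) (independent r) vπ vπ′ us (valid-unmatched vπ s us))
            (cong (branch π′ r s E) πs≡π′s)
    ... | no i≢i′ = begin
      branch π r s E i
        ≡⟨ branch-strategy r s E i (independent r) vπ vρ us ui ⟩
      branch ρ r s E i
        ≡⟨ branch-split ρ r s E fi′ ⟩
      #accepted ρ r (match s i i′) ((x i , x i′) ∷ E) + branchAvoiding ρ r s E i i′
        ≡⟨ cong₂ _+_ first-pair
                 (branchAvoiding-exchange r s E vρ vρ′ (prefer-unmatched π) (prefer-unmatched π′) ui ui′ i≢i′ us) ⟩
      #accepted ρ′ r (match s i′ i) ((x i′ , x i) ∷ E) + branchAvoiding ρ′ r s E i′ i
        ≡⟨ sym (branch-split ρ′ r s E fi) ⟩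
      branch ρ′ r s E i′
        ≡⟨ sym (branch-strategy r s E i′ (independent r) vπ′ vρ′ us ui′) ⟩
      branch π′ r s E i′ ∎
      where
      open ≡-Reasoning
      i = π s
      i′ = π′ s
      ρ = prefer i′ π
      ρ′ = prefer i π′
      vρ = prefer-valid i′ vπ
      vρ′ = prefer-valid i vπ′
      ui = valid-unmatched vπ s us
      ui′ = valid-unmatched vπ′ s us
      fi′ : free s i i′ ≡ true
      fi′ = free-intro s ui′ (i≢i′ ∘ sym)
      fi : free s i′ i ≡ true
      fi = free-intro s ui i≢i′
      first-pair : #accepted ρ r (match s i i′) ((x i , x i′) ∷ E) ≡ #accepted ρ′ r (match s i′ i) ((x i′ , x i) ∷ E)
      first-pair = begin
        #accepted ρ r (match s i i′) ((x i , x i′) ∷ E)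
          ≡⟨ independent r _ _ vρ vρ′ (#unmatched-step s i i′ r us ui fi′) ⟩
        #accepted ρ′ r (match s i i′) ((x i , x i′) ∷ E)
          ≡⟨ #accepted-resp ρ′ r _ (≈-flip (x i) (x i′) E) ⟩
        #accepted ρ′ r (match s i i′) ((x i′ , x i) ∷ E)
          ≡⟨ cong (λ S → #accepted ρ′ r S ((x i′ , x i) ∷ E)) (match-comm s i i′) ⟩
        #accepted ρ′ r (match s i′ i) ((x i′ , x i) ∷ E) ∎

    branchAvoiding-exchange : ∀ r s E {ρ ρ′ i i′} → Valid ρ → Valid ρ′ →
      (∀ S → unmatched S i′ ≡ true → ρ S ≡ i′) → (∀ S → unmatched S i ≡ true → ρ′ S ≡ i) →
      unmatched s i ≡ true → unmatched s i′ ≡ true → ¬ i ≡ i′ → #unmatched s ≡ suc r * 2 →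
      branchAvoiding ρ r s E i i′ ≡ branchAvoiding ρ′ r s E i′ i
    branchAvoiding-exchange zero s E {ρ} {ρ′} _ _ _ _ ui ui′ i≢i′ us =
      trans (branchAvoiding-zero ρ s E us ui (free-intro s ui′ (i≢i′ ∘ sym)))
            (sym (branchAvoiding-zero ρ′ s E us ui′ (free-intro s ui i≢i′)))
    branchAvoiding-exchange (suc r) s E {ρ} {ρ′} {i} {i′} vρ vρ′ ρ-prefers ρ′-prefers ui ui′ i≢i′ us = begin
      branchAvoiding ρ (suc r) s E i i′
        ≡⟨ branchAvoiding-expand ρ r s E ρ-prefers ui′ i≢i′ ⟩
      sumL (λ a → sumL (λ b → twoRounds ρ r s E i i′ a b) (allFin N)) (allFin N)
        ≡⟨ sumL-cong (λ a → sumL-cong (twoRounds-sym a) (allFin N)) (allFin N) ⟩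
      sumL (λ a → sumL (λ b → twoRounds ρ′ r s E i′ i b a) (allFin N)) (allFin N)
        ≡⟨ sumL-swap (λ a b → twoRounds ρ′ r s E i′ i b a) (allFin N) (allFin N) ⟩
      sumL (λ b → sumL (λ a → twoRounds ρ′ r s E i′ i b a) (allFin N)) (allFin N)
        ≡⟨ sym (branchAvoiding-expand ρ′ r s E ρ′-prefers ui (i≢i′ ∘ sym)) ⟩
      branchAvoiding ρ′ (suc r) s E i′ i ∎
      where
      open ≡-Reasoning
      twoRounds-sym : ∀ a b → twoRounds ρ r s E i i′ a b ≡ twoRounds ρ′ r s E i′ i b a
      twoRounds-sym a b = ⊙-cong₂ (pair-guard-sym s i i′ a b) same-runs
        where
        same-runs : ((free s i a ∧ not (a == i′)) ∧ free (match s i a) i′ b) ≡ true →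
          #accepted ρ r (match (match s i a) i′ b) ((x i′ , x b) ∷ (x i , x a) ∷ E)
            ≡ #accepted ρ′ r (match (match s i′ b) i a) ((x i , x a) ∷ (x i′ , x b) ∷ E)
        same-runs guard = begin
          #accepted ρ r (match (match s i a) i′ b) ((x i′ , x b) ∷ (x i , x a) ∷ E)
            ≡⟨ independent r _ _ vρ vρ′ (#unmatched-step (match s i a) i′ b r after-a ui′-after-a fb) ⟩
          #accepted ρ′ r (match (match s i a) i′ b) ((x i′ , x b) ∷ (x i , x a) ∷ E)
            ≡⟨ #accepted-resp ρ′ r _ (≈-swap (x i′ , x b) (x i , x a) E) ⟩
          #accepted ρ′ r (match (match s i a) i′ b) ((x i , x a) ∷ (x i′ , x b) ∷ E)
            ≡⟨ cong (λ S → #accepted ρ′ r S ((x i , x a) ∷ (x i′ , x b) ∷ E)) (match-match-comm s i a i′ b) ⟩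
          #accepted ρ′ r (match (match s i′ b) i a) ((x i , x a) ∷ (x i′ , x b) ∷ E) ∎
          where
          first : (free s i a ∧ not (a == i′)) ≡ true
          first = proj₁ (∧-true guard)
          fa : free s i a ≡ true
          fa = proj₁ (∧-true first)
          a≢i′ : not (a == i′) ≡ true
          a≢i′ = proj₂ (∧-true first)
          fb : free (match s i a) i′ b ≡ true
          fb = proj₂ (∧-true {free s i a ∧ not (a == i′)} guard)
          after-a : #unmatched (match s i a) ≡ suc r * 2
          after-a = #unmatched-step s i a (suc r) us ui fa
          ui′-after-a : unmatched (match s i a) i′ ≡ true
          ui′-after-a = unmatched-match⁺ s ui′ (i≢i′ ∘ sym) (==-false a≢i′ ∘ sym)

  #accepted≡paths : ∀ π r s E → #accepted π r s E ≡ sumL (λ p → F (pairEdges x p ++ E) ⊙ 1) (paths π r s)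
  #accepted≡paths π zero    s E = sym (+-identityʳ _)
  #accepted≡paths π (suc r) s E = begin
    branch π r s E i
      ≡⟨ sym (sumL-filterB (free s i) _ (allFin N)) ⟩
    sumL (λ j → #accepted π r (match s i j) ((x i , x j) ∷ E)) js
      ≡⟨ sumL-cong (λ j → trans (#accepted≡paths π r _ _)
                                (sumL-cong (λ p → cong (_⊙ 1) (shift j p)) (paths π r (match s i j)))) js ⟩
    sumL (λ j → sumL (λ p → F (pairEdges x ((i , j) ∷ p) ++ E) ⊙ 1) (paths π r (match s i j))) js
      ≡⟨ sumL-cong (λ j → sym (sumL-map _ ((i , j) ∷_) (paths π r (match s i j)))) js ⟩
    sumL (λ j → sumL (λ p → F (pairEdges x p ++ E) ⊙ 1) (map ((i , j) ∷_) (paths π r (match s i j)))) js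
      ≡⟨ sym (sumL-concatMap _ (λ j → map ((i , j) ∷_) (paths π r (match s i j))) js) ⟩
    sumL (λ p → F (pairEdges x p ++ E) ⊙ 1) (paths π (suc r) s) ∎
    where
    open ≡-Reasoning
    i = π s
    js = filterB (free s i) (allFin N)
    shift : ∀ j p → F (pairEdges x p ++ (x i , x j) ∷ E) ≡ F (pairEdges x ((i , j) ∷ p) ++ E)
    shift j p = F-resp (≈-mid (pairEdges x p) (x i , x j) E)

  RoundSizes : ∀ r → (Fin r → ℕ) → Set
  RoundSizes r B = ∀ k → B k ≡ r * 2 ∸ 1 ∸ 2 * toℕ k

  module _ (σ : Strategy n) (valid : Valid (σ x)) where

    runFrom : ∀ {r} {B : Fin r → ℕ} → ((k : Fin r) → Fin (B k)) → Subset N × Edges n → Subset N × Edges n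
    runFrom {r} c st = foldl (λ st k → step x σ (toℕ (c k)) st) st (allFin r)

    choices≡#accepted : ∀ r (B : Fin r → ℕ) s E → RoundSizes r B → #unmatched s ≡ r * 2 →
      sumL (λ c → F (proj₂ (runFrom c (s , E))) ⊙ 1) (allΠ r B) ≡ #accepted (σ x) r s E
    choices≡#accepted zero    B s E _     _  = +-identityʳ _
    choices≡#accepted (suc r) B s E sizes us = begin
      sumL (λ c → accept (runFrom c (s , E))) (allΠ (suc r) B)
        ≡⟨ sumL-concatMap _ (λ a → map (consΠ {B = B} a) (allΠ r B′)) (allFin (B zero)) ⟩
      sumL (λ a → sumL (λ c → accept (runFrom c (s , E))) (map (consΠ {B = B} a) (allΠ r B′))) (allFin (B zero))
        ≡⟨ sumL-cong (λ a → trans (sumL-map _ (consΠ {B = B} a) (allΠ r B′))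
                                  (sumL-cong (λ f → cong accept (after-first a f)) (allΠ r B′))) (allFin (B zero)) ⟩
      sumL (λ a → later (step x σ (toℕ a) (s , E))) (allFin (B zero))
        ≡⟨ sumL-cong (λ a → cong later (step≡advance (toℕ a))) (allFin (B zero)) ⟩
      sumL (λ a → later (advance (lookupℕ js (toℕ a)))) (allFin (B zero))
        ≡⟨ sumL-lookupℕ js length-js (later ∘ advance) ⟩
      sumL (λ j → later (advance (just j))) js
        ≡⟨ sumL-congᴬ (All-filterB (free s i) (All.universal later-rounds (allFin N))) ⟩
      sumL (λ j → #accepted (σ x) r (match s i j) ((x i , x j) ∷ E)) js
        ≡⟨ sumL-filterB (free s i) _ (allFin N) ⟩
      branch (σ x) r s E i ∎
      where
      open ≡-Reasoning
      i = σ x s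
      js = filterB (free s i) (allFin N)
      ui = valid-unmatched valid s us
      B′ : Fin r → ℕ
      B′ k = B (suc k)
      accept : Subset N × Edges n → ℕ
      accept st = F (proj₂ st) ⊙ 1
      later : Subset N × Edges n → ℕ
      later st = sumL (λ c → accept (runFrom c st)) (allΠ r B′)
      advance : Maybe (Fin N) → Subset N × Edges n
      advance (just j) = match s i j , (x i , x j) ∷ E
      advance nothing  = s , E
      step≡advance : ∀ c → step x σ c (s , E) ≡ advance (lookupℕ js c)
      step≡advance c with lookupℕ js c
      ... | just j  = refl
      ... | nothing = refl
      length-js : length js ≡ B zero
      length-js = trans (+-cancelʳ-≡ 1 _ _ (trans (length-free s ui) (trans us (sym (+-comm (suc (r * 2)) 1)))))
                        (sym (sizes zero))
      sizes′ : RoundSizes r B′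
      sizes′ k = trans (sizes (suc k))
        (trans (cong (suc (r * 2) ∸_) (*-suc 2 (toℕ k))) (sym (∸-+-assoc (r * 2) 1 (2 * toℕ k))))
      after-first : ∀ a f → runFrom (consΠ {B = B} a f) (s , E) ≡ runFrom f (step x σ (toℕ a) (s , E))
      after-first a f = foldl-tabulate (λ st k → step x σ (toℕ (consΠ {B = B} a f k)) st)
                                       (step x σ (toℕ a) (s , E)) (λ (k : Fin r) → suc k)
      later-rounds : ∀ j → free s i j ≡ true →
        later (advance (just j)) ≡ #accepted (σ x) r (match s i j) ((x i , x j) ∷ E)
      later-rounds j fj = choices≡#accepted r B′ (match s i j) _ sizes′ (#unmatched-step s i j r us ui fj)

-- Reduction to G₁

-- Any fixed x₀ will do (Xs 0 is inhabited too): σ x₀ is a strategy that ignores x.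
x₀ : ∀ {n} → Xs n
x₀ = quotient 2

count₁ : ∀ {n} → (Edges n → Bool) → ℕ
count₁ {n} F = countB (F ∘ graph1) (ΩX n)

module Counting {n} (F : Edges n → Bool) (F-resp : ∀ {E E′} → E ≈ E′ → F E ≡ F E′) where

  private
    module R = Runs F F-resp

  count-pairing : ∀ {p : Pairing (n * 2)} → Disjoint p → Covers p → countB (λ x → F (pairEdges x p)) (ΩX n) ≡ count₁ F
  count-pairing {p} disjoint covers = begin
    countB (λ x → F (pairEdges x p)) (ΩX n)
      ≡⟨ countB-cong (λ x → cong F (sym (adjacentPairs-endpoint p x))) (ΩX n) ⟩
    countB (λ x → F (adjacentPairs (length p) (x ∘ τ))) (allFuns (n * 2) n)
      ≡⟨ countB-∘-bijection τ τ⁻¹ τ∘τ⁻¹ τ⁻¹∘τ (F ∘ adjacentPairs (length p))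
                            (cong F ∘ adjacentPairs-cong (length p)) ⟩
    countB (F ∘ adjacentPairs (length p)) (allFuns (length p * 2) n)
      ≡⟨ all-pairs (length p) length-p ⟩
    count₁ F ∎
    where
    open ≡-Reasoning
    τ : Fin (length p * 2) → Fin (n * 2)
    τ = endpoint p
    τ⁻¹ : Fin (n * 2) → Fin (length p * 2)
    τ⁻¹ c = proj₁ (endpoint-surjective covers c)
    τ∘τ⁻¹ : ∀ c → τ (τ⁻¹ c) ≡ c
    τ∘τ⁻¹ c = proj₂ (endpoint-surjective covers c)
    τ⁻¹∘τ : ∀ i → τ⁻¹ (τ i) ≡ i
    τ⁻¹∘τ i = endpoint-injective disjoint (τ∘τ⁻¹ (τ i))
    τ⁻¹-injective : ∀ {c c′} → τ⁻¹ c ≡ τ⁻¹ c′ → c ≡ c′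
    τ⁻¹-injective {c} {c′} e = trans (sym (τ∘τ⁻¹ c)) (trans (cong τ e) (τ∘τ⁻¹ c′))
    length-p : length p ≡ n
    length-p = *-cancelʳ-≡ _ _ 2 (cantor-schröder-bernstein (endpoint-injective disjoint) τ⁻¹-injective)
    all-pairs : ∀ k → k ≡ n → countB (F ∘ adjacentPairs k) (allFuns (k * 2) n) ≡ count₁ F
    all-pairs _ refl = refl

  count-pairings : ∀ (P : List (Pairing (n * 2))) → All (λ p → Disjoint p × Covers p) P →
    sumL (λ p → countB (λ x → F (pairEdges x p)) (ΩX n)) P ≡ length P * count₁ F
  count-pairings P perfect =
    trans (sumL-congᴬ (All.map (λ perf → count-pairing (proj₁ perf) (proj₂ perf)) perfect)) (sumL-const (count₁ F) P)

  interleave : (Fin n → Fin n) × (Fin n → Fin n) → Xs n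
  interleave h i = select (proj₂ (remQuot {n} 2 i)) h (proj₁ (remQuot {n} 2 i))

  interleave-combine : ∀ h t b → interleave h (combine t b) ≡ select b h t
  interleave-combine h t b = cong (λ r → select (proj₂ r) h (proj₁ r)) (remQuot-combine {n} {2} t b)

  count-G : countB (F ∘ graphG) (ΩG n) ≡ count₁ F
  count-G = countB-bijective (λ h x → x ≐ interleave h) (ΩG n) (ΩX n)
    (All.universal (λ h → countB-≐ (n * 2) _ (interleave h)) (ΩG n))
    (All.universal one-preimage (ΩX n))
    (λ h x x≐h → cong F (map-cong (λ t → sym (cong₂ _,_ (on-x x≐h t zero) (on-x x≐h t (suc zero)))) (allFin n)))
    where
    on-x : ∀ {h x} → (x ≐ interleave h) ≡ true → ∀ t b → x (combine t b) ≡ select b h t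
    on-x {h} x≐h t b = trans (≐⇒≗ x≐h (combine t b)) (interleave-combine h t b)
    halves : Xs n → Fin 2 → Fin n → Fin n
    halves x b t = x (combine t b)
    deinterleave : ∀ x h → (x ≐ interleave h) ≡ (proj₁ h ≐ halves x zero) ∧ (proj₂ h ≐ halves x (suc zero))
    deinterleave x h = ⇔→≡ (mk⇔
      (λ x≐h → ∧-intro (≗⇒≐ (λ t → sym (on-x x≐h t zero))) (≗⇒≐ (λ t → sym (on-x x≐h t (suc zero)))))
      (λ h≐x → ≗⇒≐ (λ i → trans (cong x (sym (combine-remQuot {n} 2 i)))
                            (sym (select-≐ h≐x (proj₁ (remQuot {n} 2 i)) (proj₂ (remQuot {n} 2 i)))))))
      where
      select-≐ : (proj₁ h ≐ halves x zero) ∧ (proj₂ h ≐ halves x (suc zero)) ≡ true →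
        ∀ t b → select b h t ≡ halves x b t
      select-≐ h≐x t zero       = ≐⇒≗ (proj₁ (∧-true h≐x)) t
      select-≐ h≐x t (suc zero) = ≐⇒≗ (proj₂ (∧-true {proj₁ h ≐ halves x zero} h≐x)) t
    one-preimage : ∀ x → countB (λ h → x ≐ interleave h) (ΩG n) ≡ 1
    one-preimage x = begin
      countB (λ h → x ≐ interleave h) (ΩG n)
        ≡⟨ countB-cong (deinterleave x) (ΩG n) ⟩
      countB (λ h → (proj₁ h ≐ halves x zero) ∧ (proj₂ h ≐ halves x (suc zero))) (ΩG n)
        ≡⟨ countB-allPairs (_≐ halves x zero) (_≐ halves x (suc zero)) (allFuns n n) (allFuns n n) ⟩
      countB (_≐ halves x zero) (allFuns n n) * countB (_≐ halves x (suc zero)) (allFuns n n)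
        ≡⟨ cong₂ _*_ (countB-≐ n _ (halves x zero)) (countB-≐ n _ (halves x (suc zero))) ⟩
      1 ∎
      where open ≡-Reasoning

  count-G₂ : countB (F ∘ graph2) (Ω2 n) ≡ length (allMatchings (n * 2)) * count₁ F
  count-G₂ = begin
    countB (F ∘ graph2) (Ω2 n)
      ≡⟨ countB≡sumL _ (Ω2 n) ⟩
    sumL (λ xM → F (graph2 xM) ⊙ 1) (allPairs (ΩX n) Ms)
      ≡⟨ sumL-allPairs _ (ΩX n) Ms ⟩
    sumL (λ x → sumL (λ M → F (graph2 (x , M)) ⊙ 1) Ms) (ΩX n)
      ≡⟨ sumL-swap (λ x M → F (graph2 (x , M)) ⊙ 1) (ΩX n) Ms ⟩
    sumL (λ M → sumL (λ x → F (graph2 (x , M)) ⊙ 1) (ΩX n)) Ms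
      ≡⟨ sumL-cong (λ M → sym (countB≡sumL (λ x → F (graph2 (x , M))) (ΩX n))) Ms ⟩
    sumL (λ M → countB (λ x → F (graph2 (x , M))) (ΩX n)) Ms
      ≡⟨ sumL-cong (λ M → countB-cong (λ x → cong F (map-∘ (filterB (lowerEnd M) (allFin (n * 2))))) (ΩX n)) Ms ⟩
    sumL (λ M → countB (λ x → F (pairEdges x (matchingPairing M))) (ΩX n)) Ms
      ≡⟨ sym (sumL-map _ matchingPairing Ms) ⟩
    sumL (λ p → countB (λ x → F (pairEdges x p)) (ΩX n)) (map matchingPairing Ms)
      ≡⟨ count-pairings _ (Allₚ.map⁺ (All-filterB isPerfectMatching
           (All.universal (λ M → perfectMatching-perfect {M = M}) (allFuns (n * 2) (n * 2))))) ⟩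
    length (map matchingPairing Ms) * count₁ F
      ≡⟨ cong (_* count₁ F) (length-map matchingPairing Ms) ⟩
    length Ms * count₁ F ∎
    where
    open ≡-Reasoning
    Ms = allMatchings (n * 2)

  count-G₃ : ∀ σ → ValidStrategy σ → countB (F ∘ graph3 σ) (Ω3 n) ≡ length (paths (σ x₀) n ∅) * count₁ F
  count-G₃ σ valid = begin
    countB (F ∘ graph3 σ) (Ω3 n)
      ≡⟨ countB≡sumL _ (Ω3 n) ⟩
    sumL (λ xc → F (graph3 σ xc) ⊙ 1) (allPairs (ΩX n) (allΠ n (choices n)))
      ≡⟨ sumL-allPairs _ (ΩX n) (allΠ n (choices n)) ⟩
    sumL (λ x → sumL (λ c → F (graph3 σ (x , c)) ⊙ 1) (allΠ n (choices n))) (ΩX n)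
      ≡⟨ sumL-cong (λ x → R.choices≡#accepted x σ (valid x) n (choices n) ∅ [] (λ _ → refl) all-unmatched) (ΩX n) ⟩
    sumL (λ x → R.#accepted x (σ x) n ∅ []) (ΩX n)
      ≡⟨ sumL-cong (λ x → R.independent x n ∅ [] (valid x) (valid x₀) all-unmatched) (ΩX n) ⟩
    sumL (λ x → R.#accepted x (σ x₀) n ∅ []) (ΩX n)
      ≡⟨ sumL-cong (λ x → R.#accepted≡paths x (σ x₀) n ∅ []) (ΩX n) ⟩
    sumL (λ x → sumL (λ p → F (pairEdges x p ++ []) ⊙ 1) P) (ΩX n)
      ≡⟨ sumL-swap (λ x p → F (pairEdges x p ++ []) ⊙ 1) (ΩX n) P ⟩
    sumL (λ p → sumL (λ x → F (pairEdges x p ++ []) ⊙ 1) (ΩX n)) P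
      ≡⟨ sumL-cong (λ p → trans (sumL-cong (λ x → cong (λ E → F E ⊙ 1) (++-identityʳ (pairEdges x p))) (ΩX n))
                                (sym (countB≡sumL _ (ΩX n)))) P ⟩
    sumL (λ p → countB (λ x → F (pairEdges x p)) (ΩX n)) P
      ≡⟨ count-pairings P (All.map (λ perf → proj₁ perf , λ c → proj₂ (proj₂ perf) c (cong not (lookup-replicate c false)))
                                   (paths-perfect (valid x₀) n ∅ all-unmatched)) ⟩
    length P * count₁ F ∎
    where
    open ≡-Reasoning
    P = paths (σ x₀) n ∅
    all-unmatched : #unmatched (∅ {n * 2}) ≡ n * 2
    all-unmatched = #unmatched-∅ (n * 2)

record Proportional {n} {A : Set} (Ω : List A) (g : A → Edges n) (c : ℕ) : Set where
  constructor proportional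
  field
    counts : ∀ (F : Edges n → Bool) → (∀ {E E′} → E ≈ E′ → F E ≡ F E′) → countB (F ∘ g) Ω ≡ c * count₁ F

proportional⇒sameDist : ∀ {n} {A B : Set} {Ω₁ : List A} {g₁ : A → Edges n} {Ω₂ : List B} {g₂ : B → Edges n}
  {c₁ c₂} →
  Proportional Ω₁ g₁ c₁ → Proportional Ω₂ g₂ c₂ → SameDist Ω₁ g₁ Ω₂ g₂
proportional⇒sameDist {n} {Ω₁ = Ω₁} {g₁} {Ω₂} {g₂} {c₁} {c₂} P₁ P₂ H = begin
  countGraph Ω₁ g₁ H * length Ω₂   ≡⟨ cong₂ _*_ (counts P₁ isH (λ {E} {E′} → respH {E} {E′})) (size P₂) ⟩
  (c₁ * a) * (c₂ * b)              ≡⟨ exchange c₁ c₂ a b ⟩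
  (c₂ * a) * (c₁ * b)              ≡⟨ sym (cong₂ _*_ (counts P₂ isH (λ {E} {E′} → respH {E} {E′})) (size P₁)) ⟩
  countGraph Ω₂ g₂ H * length Ω₁   ∎
  where
  open ≡-Reasoning
  open Proportional
  isH = λ E → sameGraph E H
  -- passed eta-expanded below: _≈_ unfolds to a Π-type, from which E and E′ cannot be inferred
  respH : ∀ {E E′} → E ≈ E′ → isH E ≡ isH E′
  respH {E} {E′} = sameGraph-resp H {E} {E′}
  a = count₁ isH
  b = count₁ {n} (λ _ → true)
  size : ∀ {C : Set} {Ω : List C} {g c} → Proportional Ω g c → length Ω ≡ c * b
  size {Ω = Ω} P = trans (sym (countB-true Ω)) (counts P (λ _ → true) (λ {E} {E′} _ → refl))
  exchange : ∀ c₁ c₂ a b → (c₁ * a) * (c₂ * b) ≡ (c₂ * a) * (c₁ * b)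
  exchange = +-*-Solver.solve 4 (λ c₁ c₂ a b → (c₁ :* a) :* (c₂ :* b) := (c₂ :* a) :* (c₁ :* b)) refl
    where open +-*-Solver

lemma5p2 : ∀ (n : ℕ) →
    SameDist (ΩG n) graphG (ΩX n) graph1
    × SameDist (ΩG n) graphG (Ω2 n) graph2
    × (∀ (σ : Strategy n) → ValidStrategy σ →
         SameDist (ΩG n) graphG (Ω3 n) (graph3 σ))
lemma5p2 n =
  proportional⇒sameDist G G₁ , proportional⇒sameDist G G₂ , λ σ valid → proportional⇒sameDist G (G₃ σ valid)
  where
  G : Proportional (ΩG n) graphG 1
  G = proportional λ F F-resp → trans (Counting.count-G F F-resp) (sym (*-identityˡ _))
  G₁ : Proportional (ΩX n) graph1 1
  G₁ = proportional λ F _ → sym (*-identityˡ _)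
  G₂ : Proportional (Ω2 n) graph2 (length (allMatchings (n * 2)))
  G₂ = proportional Counting.count-G₂
  G₃ : ∀ σ → ValidStrategy σ → Proportional (Ω3 n) (graph3 σ) (length (paths (σ x₀) n ∅))
  G₃ σ valid = proportional λ F F-resp → Counting.count-G₃ F F-resp σ valid
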